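{- Let $C$ and $C'$ be configurations of a channel system. Then $C \to^{*}_{\text{pure-lossy}} C''$ for some $C'' \succeq C'$ if and only if $C \to^{*}_{\text{semi-lossy}} C''$ for some $C'' \succeq C'$. Furthermore, the semi-lossy transition relation $\to_{\text{semi-lossy}}$ is monotone with respect to $\preceq$.
   Context: A channel system is a finite directed graph whose nodes $P$ are called states and whose arcs (transitions) are labeled by a read operation "read $a$ from channel $i$", a write operation "write $a$ to channel $i$", or a no-op, with $a \in \Gamma$ (a finite channel alphabet) and $i \in [1..k]$. There are $m$ processes, each in some state, evolving by reading letters from the left of channels, writing letters to the right of channels, and moving along arcs. A configuration is a tuple $C = (X, w_1, \ldots, w_k)$ where $X = [p_1, \ldots, p_m]$ lists the states of the processes and $w_i \in \Gamma^*$ is the content of channel $i$. Under the pure-lossy semantics ($\to_{\text{pure-lossy}}$), transitions behave as in an ordinary channel system and, in addition, any letter may be lost at any moment from any channel. Under the semi-lossy semantics ($\to_{\text{semi-lossy}}$), write and no-op transitions are non-lossy, and a transition reading $a$ from channel $i$, applied when $w_i = x a y$ with $x$ containing no $a$, replaces $w_i$ by $y$ (i.e., all letters in front of the first $a$ are lost together with that $a$). For configurations $C = (X, w_1, \ldots, w_k)$ and $C' = (X', w_1', \ldots, w_k')$, write $C \preceq C'$ iff $X = X'$ and $w_i \sqsubseteq w_i'$ for all $i \in [1..k]$, where $\sqsubseteq$ is the (scattered) subword order; $\preceq$ is a well-quasi-order by Higman's lemma. A labeled transition relation is monotone if $C \to^{t} D$ and $C' \succeq C$ imply $C' \to^{t}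 D'$ for some $D' \succeq D$. -}

module Defs where

open import Data.Nat using (ℕ)
open import Data.Fin using (Fin)
open import Data.List using (List; []; _∷_; _++_; [_])
open import Data.List.Membership.Propositional using (_∈_; _∉_)
open import Data.List.Relation.Binary.Sublist.Propositional using (_⊆_)
open import Data.Vec using (Vec; lookup; _[_]≔_)
open import Data.Vec.Relation.Binary.Pointwise.Inductive using (Pointwise)
open import Data.Product using (_×_; _,_; Σ; ∃)
open import Relation.Binary.PropositionalEquality using (_≡_)
open import Relation.Binary.Construct.Closure.ReflexiveTransitive using (Star)

data Op (g k : ℕ) : Set where
  read  : Fin g → Fin k → Op g k
  write : Fin g → Fin k → Op g k
  nop   : Op g k

record Arc (n g k : ℕ) : Set where
  constructor arc
  field
    src : Fin n
    op  : Op g k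
    tgt : Fin n

-- A channel system: states Fin n, alphabet Fin g, k channels,
-- a finite set of arcs given as a list.
record ChannelSystem (n g k : ℕ) : Set where
  field
    arcs : List (Arc n g k)

-- Configurations for m processes: states of processes and channel contents.
Config : (n g k m : ℕ) → Set
Config n g k m = Vec (Fin n) m × Vec (List (Fin g)) k

module _ {n g k : ℕ} (S : ChannelSystem n g k) {m : ℕ} where
  open ChannelSystem S

  Label : Set
  Label = Fin m × Arc n g k

  data PerfectStep : Config n g k m → Label → Config n g k m → Set where
    p-read : ∀ {X ws j p q a i y} →
      arc p (read a i) q ∈ arcs → lookup X j ≡ p →
      lookup ws i ≡ a ∷ y →
      PerfectStep (X , ws) (j , arc p (read a i) q) (X [ j ]≔ q , ws [ i ]≔ y)
    p-write : ∀ {X ws j p q a i} →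
      arc p (write a i) q ∈ arcs → lookup X j ≡ p →
      PerfectStep (X , ws) (j , arc p (write a i) q)
                  (X [ j ]≔ q , ws [ i ]≔ (lookup ws i ++ [ a ]))
    p-nop : ∀ {X ws j p q} →
      arc p nop q ∈ arcs → lookup X j ≡ p →
      PerfectStep (X , ws) (j , arc p nop q) (X [ j ]≔ q , ws)

  data PureLossyStep : Config n g k m → Config n g k m → Set where
    pl-step : ∀ {C t D} → PerfectStep C t D → PureLossyStep C D
    pl-lose : ∀ {X ws i x a y} → lookup ws i ≡ x ++ a ∷ y →
      PureLossyStep (X , ws) (X , ws [ i ]≔ (x ++ y))

  data SemiLossyStep : Config n g k m → Label → Config n g k m → Set where
    sl-read : ∀ {X ws j p q a i x y} →
      arc p (read a i) q ∈ arcs → lookup X j ≡ p →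
      lookup ws i ≡ x ++ a ∷ y → a ∉ x →
      SemiLossyStep (X , ws) (j , arc p (read a i) q) (X [ j ]≔ q , ws [ i ]≔ y)
    sl-write : ∀ {X ws j p q a i} →
      arc p (write a i) q ∈ arcs → lookup X j ≡ p →
      SemiLossyStep (X , ws) (j , arc p (write a i) q)
                    (X [ j ]≔ q , ws [ i ]≔ (lookup ws i ++ [ a ]))
    sl-nop : ∀ {X ws j p q} →
      arc p nop q ∈ arcs → lookup X j ≡ p →
      SemiLossyStep (X , ws) (j , arc p nop q) (X [ j ]≔ q , ws)

  SemiLossy : Config n g k m → Config n g k m → Set
  SemiLossy C D = ∃ λ t → SemiLossyStep C t D

  PureLossy* : Config n g k m → Config n g k m → Set
  PureLossy* = Star PureLossyStep

  SemiLossy* : Config n g k m → Config n g k m → Set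
  SemiLossy* = Star SemiLossy

_⪯_ : ∀ {n g k m} → Config n g k m → Config n g k m → Set
(X , ws) ⪯ (X' , ws') = X ≡ X' × Pointwise _⊆_ ws ws'

Monotone : ∀ {n g k m} {L : Set} →
  (Config n g k m → L → Config n g k m → Set) → Set
Monotone {n} {g} {k} {m} R = ∀ {C C' D : Config n g k m} {t} →
  R C t D → C ⪯ C' → Σ (Config n g k m) λ D' → R C' t D' × D ⪯ D'

{-# OPTIONS --safe #-}
-- A semi-lossy read of a from w = x a y is a pure-lossy run: lose the letters of
-- x one by one, then read a perfectly. Conversely, losses only move a
-- configuration down in ⪯, and a perfect step is a semi-lossy step, so a
-- pure-lossy run from C is simulated from any C' ⪰ C by a semi-lossy run once
-- semi-lossy steps are monotone. Monotonicity is the greedy embedding of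
-- subwords: if a y ⊑ w' then reading the first a of w' leaves a suffix above y.
module Submission where

open import Defs
open import Data.Nat using (ℕ)
open import Data.Product using (_×_; Σ; ∃₂; _,_)
open import Function.Base using (_∘_)
open import Function.Bundles using (_⇔_; mk⇔)
open import Data.List using (List; []; _∷_; _++_)
open import Data.List.Membership.Propositional using (_∉_)
open import Data.List.Relation.Unary.Any using (here; there)
open import Data.List.Relation.Binary.Sublist.Heterogeneous using (_∷_; _∷ʳ_)
open import Data.List.Relation.Binary.Sublist.Propositional using (_⊆_; ⊆-refl; ⊆-trans)
open import Data.List.Relation.Binary.Sublist.Propositional.Properties using (∷ˡ⁻; ++⁺; ++⁺ˡ)
open import Data.Vec using (Vec; lookup; _[_]≔_)
open import Data.Vec.Properties using ([]≔-idempotent; []≔-lookup; lookup∘update)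
open import Data.Vec.Relation.Binary.Pointwise.Inductive as Pointwise
  using (Pointwise; _∷_)
open import Data.Fin as Fin using (Fin; zero; suc)
open import Level using (0ℓ)
open import Relation.Binary.Core using (Rel)
open import Relation.Binary.Definitions using (Reflexive; DecidableEquality)
open import Relation.Binary.PropositionalEquality using (_≡_; refl; sym; trans; subst; cong)
open import Relation.Binary.Construct.Closure.ReflexiveTransitive using (ε; _◅_; _◅◅_)
open import Relation.Nullary using (yes; no)

private
  variable
    A : Set

⊆-firstOccurrence : DecidableEquality A → {a : A} {y w : List A} → (a ∷ y) ⊆ w →
  ∃₂ λ x y' → w ≡ x ++ a ∷ y' × a ∉ x × y ⊆ y'
⊆-firstOccurrence _≟_ (refl ∷ y⊆w) = [] , _ , refl , (λ ()) , y⊆w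
⊆-firstOccurrence _≟_ {a} (b ∷ʳ ay⊆w) with b ≟ a
... | yes refl = [] , _ , refl , (λ ()) , ∷ˡ⁻ ay⊆w
... | no b≢a with ⊆-firstOccurrence _≟_ ay⊆w
...   | x , y' , w≡xay' , a∉x , y⊆y' = b ∷ x , y' , cong (b ∷_) w≡xay' , a∉bx , y⊆y'
  where
  a∉bx : a ∉ b ∷ x
  a∉bx (here a≡b) = b≢a (sym a≡b)
  a∉bx (there a∈x) = a∉x a∈x

Pointwise-[]≔⁺ : ∀ {R : Rel A 0ℓ} {k} {us vs : Vec A k} → Pointwise R us vs →
  ∀ i {a b} → R a b → Pointwise R (us [ i ]≔ a) (vs [ i ]≔ b)
Pointwise-[]≔⁺ (_ ∷ rs) zero r = r ∷ rs
Pointwise-[]≔⁺ (r ∷ rs) (suc i) r′ = r ∷ Pointwise-[]≔⁺ rs i r′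

[]≔-shrink : ∀ {k} (ws : Vec (List A) k) i {a} → a ⊆ lookup ws i →
  Pointwise _⊆_ (ws [ i ]≔ a) ws
[]≔-shrink ws i a⊆wsᵢ = subst (Pointwise _⊆_ _) ([]≔-lookup ws i)
  (Pointwise-[]≔⁺ (Pointwise.refl ⊆-refl) i a⊆wsᵢ)

module _ {n g k m : ℕ} where

  Coverable : Rel (Config n g k m) 0ℓ → Rel (Config n g k m) 0ℓ
  Coverable _⟶*_ C C' = Σ (Config n g k m) λ C'' → C ⟶* C'' × C' ⪯ C''

  ⪯-refl : Reflexive (_⪯_ {n} {g} {k} {m})
  ⪯-refl = refl , Pointwise.refl ⊆-refl

  ⪯-trans : {C D E : Config n g k m} → C ⪯ D → D ⪯ E → C ⪯ E
  ⪯-trans {_ , _} {_ , _} {_ , _} (refl , p) (refl , q) =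
    refl , Pointwise.trans ⊆-trans p q

module _ {n g k m : ℕ} (S : ChannelSystem n g k) where

  PerfectStep⇒SemiLossyStep : ∀ {C t D} → PerfectStep S {m} C t D → SemiLossyStep S C t D
  PerfectStep⇒SemiLossyStep (p-read a∈S Xⱼ≡p wsᵢ≡ay) = sl-read {x = []} a∈S Xⱼ≡p wsᵢ≡ay (λ ())
  PerfectStep⇒SemiLossyStep (p-write a∈S Xⱼ≡p) = sl-write a∈S Xⱼ≡p
  PerfectStep⇒SemiLossyStep (p-nop a∈S Xⱼ≡p) = sl-nop a∈S Xⱼ≡p

  semiLossy-monotone : Monotone (SemiLossyStep S {m})
  semiLossy-monotone {X , ws} {_ , ws'}
    (sl-read {j = j} {q = q} {a = a} {i = i} {x = x} a∈S Xⱼ≡p wsᵢ≡xay a∉x) (refl , ws⊆ws')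
    with ⊆-firstOccurrence Fin._≟_ (⊆-trans (++⁺ˡ x ⊆-refl)
           (subst (_⊆ lookup ws' i) wsᵢ≡xay (Pointwise.lookup ws⊆ws' i)))
  ... | x' , y' , ws'ᵢ≡x'ay' , a∉x' , y⊆y' =
    (X [ j ]≔ q , ws' [ i ]≔ y') , sl-read a∈S Xⱼ≡p ws'ᵢ≡x'ay' a∉x' ,
    refl , Pointwise-[]≔⁺ ws⊆ws' i y⊆y'
  semiLossy-monotone (sl-write {a = a} {i = i} a∈S Xⱼ≡p) (refl , ws⊆ws') =
    _ , sl-write a∈S Xⱼ≡p ,
    refl , Pointwise-[]≔⁺ ws⊆ws' i (++⁺ (Pointwise.lookup ws⊆ws' i) ⊆-refl)
  semiLossy-monotone (sl-nop a∈S Xⱼ≡p) (refl , ws⊆ws') =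
    _ , sl-nop a∈S Xⱼ≡p , refl , ws⊆ws'

  PureLossy*-simulation : ∀ {C D C' : Config n g k m} → PureLossy* S C D → C ⪯ C' →
    Coverable (SemiLossy* S) C' D
  PureLossy*-simulation ε C⪯C' = _ , ε , C⪯C'
  PureLossy*-simulation (pl-step {t = t} step ◅ run) C⪯C'
    with semiLossy-monotone (PerfectStep⇒SemiLossyStep step) C⪯C'
  ... | _ , step' , D⪯D' with PureLossy*-simulation run D⪯D'
  ...   | E' , run' , E⪯E' = E' , (t , step') ◅ run' , E⪯E'
  PureLossy*-simulation (pl-lose {ws = ws} {i = i} {x = x} {a = a} {y = y} wsᵢ≡xay ◅ run) C⪯C' =
    PureLossy*-simulation run (⪯-trans (refl , []≔-shrink ws i lost⊆wsᵢ) C⪯C')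
    where
    lost⊆wsᵢ : x ++ y ⊆ lookup ws i
    lost⊆wsᵢ = subst (x ++ y ⊆_) (sym wsᵢ≡xay) (++⁺ ⊆-refl (a ∷ʳ ⊆-refl))

  PureLossy*-dropPrefix : ∀ X ws i (x z : List (Fin g)) → lookup ws i ≡ x ++ z →
    PureLossy* S {m} (X , ws) (X , ws [ i ]≔ z)
  PureLossy*-dropPrefix X ws i [] z wsᵢ≡z =
    subst (PureLossy* S (X , ws) ∘ (X ,_))
      (trans (sym ([]≔-lookup ws i)) (cong (ws [ i ]≔_) wsᵢ≡z)) ε
  PureLossy*-dropPrefix X ws i (b ∷ x) z wsᵢ≡bxz =
    pl-lose {x = []} wsᵢ≡bxz ◅
    subst (PureLossy* S (X , ws [ i ]≔ (x ++ z)) ∘ (X ,_)) ([]≔-idempotent ws i)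
      (PureLossy*-dropPrefix X (ws [ i ]≔ (x ++ z)) i x z (lookup∘update i ws (x ++ z)))

  SemiLossyStep⇒PureLossy* : ∀ {C t D} → SemiLossyStep S {m} C t D → PureLossy* S C D
  SemiLossyStep⇒PureLossy* {X , ws}
    (sl-read {j = j} {q = q} {a = a} {i = i} {x = x} {y = y} a∈S Xⱼ≡p wsᵢ≡xay _) =
    PureLossy*-dropPrefix X ws i x (a ∷ y) wsᵢ≡xay ◅◅
    subst (PureLossy* S (X , ws [ i ]≔ (a ∷ y)) ∘ (X [ j ]≔ q ,_)) ([]≔-idempotent ws i)
      (pl-step (p-read a∈S Xⱼ≡p (lookup∘update i ws (a ∷ y))) ◅ ε)
  SemiLossyStep⇒PureLossy* (sl-write a∈S Xⱼ≡p) = pl-step (p-write a∈S Xⱼ≡p) ◅ ε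
  SemiLossyStep⇒PureLossy* (sl-nop a∈S Xⱼ≡p) = pl-step (p-nop a∈S Xⱼ≡p) ◅ ε

  SemiLossy*⇒PureLossy* : ∀ {C D} → SemiLossy* S {m} C D → PureLossy* S C D
  SemiLossy*⇒PureLossy* ε = ε
  SemiLossy*⇒PureLossy* ((_ , step) ◅ run) =
    SemiLossyStep⇒PureLossy* step ◅◅ SemiLossy*⇒PureLossy* run

  pureCoverable⇒semiCoverable : ∀ {C C'} → Coverable (PureLossy* S) C C' → Coverable (SemiLossy* S) C C'
  pureCoverable⇒semiCoverable (_ , run , C'⪯C'') with PureLossy*-simulation run ⪯-refl
  ... | D , run' , C''⪯D = D , run' , ⪯-trans C'⪯C'' C''⪯D

  semiCoverable⇒pureCoverable : ∀ {C C'} → Coverable (SemiLossy* S) C C' → Coverable (PureLossy* S) C C'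
  semiCoverable⇒pureCoverable (C'' , run , C'⪯C'') = C'' , SemiLossy*⇒PureLossy* run , C'⪯C''

proposition12 : ∀ {n g k m : ℕ} (S : ChannelSystem n g k) →
    (∀ (C C' : Config n g k m) →
      (Σ (Config n g k m) λ C'' → PureLossy* S C C'' × C' ⪯ C'')
      ⇔ (Σ (Config n g k m) λ C'' → SemiLossy* S C C'' × C' ⪯ C''))
    × Monotone (SemiLossyStep S {m})
proposition12 S = (λ C C' → mk⇔ (pureCoverable⇒semiCoverable S) (semiCoverable⇒pureCoverable S))
                , semiLossy-monotone S
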